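{- Let $x\in D$ and suppose $0,\frac{q^2+1}{2}\in C_x$. Then for every $i\in C_x$, also $-i\in C_x$.
   Context: $q$ is an odd prime power, $\alpha$ a primitive element of $\mathbb{F}_{q^4}$, $\mathrm{Tr}(a)=a+a^q+a^{q^2}+a^{q^3}$. Let $n=(q^2+1)(q+1)$, $D=\{i\in\mathbb{Z}_n:\mathrm{Tr}(\alpha^i)=0\}$. For $x\in D$, $C_x=\{i\in\mathbb{Z}_{q^2+1}:\mathrm{Tr}(\alpha^{x+(q+1)i})=0\}$, i.e. the $i\in\{0,\dots,q^2\}$ with $x+(q+1)i\in D$; arithmetic on elements of $C_x$ is modulo $q^2+1$. -}

module Defs where

open import Level using (Level)
open import Data.Nat as ℕ using (ℕ; suc; _<_; _≤_)
open import Data.Nat.Primality using (Prime)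
open import Data.Nat.DivMod using (_%_)
open import Data.Product using (Σ; ∃; _×_)
open import Relation.Nullary using (¬_)
open import Relation.Binary.PropositionalEquality using (_≡_; _≢_)
open import Algebra.Bundles using (CommutativeRing; Semiring)
import Algebra.Definitions.RawSemiring as RS

OddPrimePower : ℕ → Set
OddPrimePower q = Σ ℕ λ p → Σ ℕ λ k → Prime p × p ≢ 2 × 1 ≤ k × q ≡ p ℕ.^ k

module _ {c ℓ : Level} (R : CommutativeRing c ℓ) where
  open CommutativeRing R
  open RS (Semiring.rawSemiring semiring) using (_^_)

  IsField : Set (c Level.⊔ ℓ)
  IsField = ¬ (1# ≈ 0#) × (∀ a → ¬ (a ≈ 0#) → ∃ λ b → a * b ≈ 1#)

  -- α is a primitive element of a field with N+1 elements:
  -- α has multiplicative order exactly N and every nonzero element is a power of α.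
  -- (With N = q^4 - 1 this forces the field to be F_{q^4}.)
  IsPrimitive : ℕ → Carrier → Set (c Level.⊔ ℓ)
  IsPrimitive N α =
      α ^ N ≈ 1#
    × (∀ j → 0 < j → j < N → ¬ (α ^ j ≈ 1#))
    × (∀ a → ¬ (a ≈ 0#) → Σ ℕ λ j → j < N × a ≈ α ^ j)

  Tr : ℕ → Carrier → Carrier
  Tr q a = a + a ^ q + a ^ (q ℕ.^ 2) + a ^ (q ℕ.^ 3)

  nOf : ℕ → ℕ
  nOf q = (q ℕ.^ 2 ℕ.+ 1) ℕ.* (q ℕ.+ 1)

  -- x ∈ D  (x ∈ Z_n represented by 0 ≤ x < n)
  InD : ℕ → Carrier → ℕ → Set ℓ
  InD q α x = x < nOf q × Tr q (α ^ x) ≈ 0#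

  -- i ∈ C_x  (i ∈ Z_{q^2+1} represented by 0 ≤ i ≤ q^2)
  InC : ℕ → Carrier → ℕ → ℕ → Set ℓ
  InC q α x i = i < q ℕ.^ 2 ℕ.+ 1 × Tr q (α ^ (x ℕ.+ (q ℕ.+ 1) ℕ.* i)) ≈ 0#

-- -i modulo q^2+1, for 0 ≤ i ≤ q^2
negMod : ℕ → ℕ → ℕ
negMod q i = (suc (q ℕ.^ 2) ℕ.∸ i) % suc (q ℕ.^ 2)

-- (q^2+1)/2 (q odd, so q^2+1 is even)
halfMod : ℕ → ℕ
halfMod q = (q ℕ.^ 2 ℕ.+ 1) ℕ./ 2

{-# OPTIONS --safe #-}
-- Write β = α^x and γ = α^(q+1), so that i ∈ C_x means Tr(β γ^i) = 0, and write a⁽ᵏ⁾ = a^(q^k).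
-- Since α^((q⁴-1)/2) = -1 ≠ 1, the element g = γ^((q²+1)/2) satisfies g^q = -g; hence Tr(β) = 0 and
-- Tr(β g) = 0 say that β + β⁽²⁾ and β⁽¹⁾ + β⁽³⁾ have zero sum and zero difference, so β⁽²⁾ = -β.
-- Finally η = γ^(q²+1) satisfies η^q = η, and if r + i = m (q²+1) then
-- η^i β γ^r = η^m β (γ^i)⁽²⁾ = -η^m (β γ^i)⁽²⁾, so η^i Tr(β γ^r) = -η^m Tr(β γ^i) = 0.
module Submission where

open import Defs
open import Level using (Level)
open import Algebra.Bundles using (CommutativeRing)
open import Relation.Binary.PropositionalEquality using (_≡_)
import Relation.Binary.PropositionalEquality as ≡
open import Data.Nat as ℕ using (ℕ; zero; suc; _∸_; NonZero)
import Data.Nat.Properties as ℕₚ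
open import Data.Nat.Divisibility using (_∣_; divides)
open import Data.Product using (∃-syntax; _×_; _,_; proj₁; proj₂)
open import Relation.Nullary using (¬_)

module Arithmetic where
  open import Data.Nat
  open import Data.Nat.Properties
  open import Data.Nat.DivMod using (_%_; _/_; m≡m%n+[m/n]*n; m%n<n; %-distribˡ-+; m%n%n≡m%n; n%n≡0)
  open import Data.Nat.Divisibility using (m%n≡0⇒n∣m; ∣1⇒≡1; n∣m*n)
  open import Data.Nat.Primality using (Prime; prime[2]; ¬prime[1]; prime⇒irreducible; euclidsLemma)
  open import Data.Nat.Solver using (module +-*-Solver)
  open import Data.Sum using (inj₁; inj₂; [_,_]′)
  open import Relation.Binary.PropositionalEquality
  open import Relation.Nullary using (contradiction)
  open +-*-Solver using (solve; _:=_; _:+_; _:*_; con)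
  open ≡-Reasoning

  ¬2∣odd-prime : ∀ {p} → Prime p → p ≢ 2 → ¬ 2 ∣ p
  ¬2∣odd-prime p-prime p≢2 2∣p with prime⇒irreducible p-prime 2∣p
  ... | inj₁ ()
  ... | inj₂ 2≡p = p≢2 (sym 2≡p)

  ¬2∣^ : ∀ {m} → ¬ 2 ∣ m → ∀ k → ¬ 2 ∣ m ^ k
  ¬2∣^ _     zero    2∣1       = contradiction (∣1⇒≡1 2∣1) λ ()
  ¬2∣^ {m} ¬2∣m (suc k) 2∣m*m^k = [ ¬2∣m , ¬2∣^ ¬2∣m k ]′ (euclidsLemma m (m ^ k) prime[2] 2∣m*m^k)

  ¬2∣⇒odd : ∀ {m} → ¬ 2 ∣ m → ∃[ t ] m ≡ suc (2 * t)
  ¬2∣⇒odd {m} ¬2∣m = m / 2 , (begin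
    m                   ≡⟨ m≡m%n+[m/n]*n m 2 ⟩
    m % 2 + m / 2 * 2   ≡⟨ cong (_+ m / 2 * 2) m%2≡1 ⟩
    suc (m / 2 * 2)     ≡⟨ cong suc (*-comm (m / 2) 2) ⟩
    suc (2 * (m / 2))   ∎)
    where
    m%2≡1 : m % 2 ≡ 1
    m%2≡1 with m % 2 | m%n<n m 2 | m%n≡0⇒n∣m m 2
    ... | 0           | _            | 2∣m = contradiction (2∣m refl) ¬2∣m
    ... | 1           | _            | _   = refl
    ... | suc (suc _) | s≤s (s≤s ()) | _

  oddPrimePower⇒odd : ∀ {q} → OddPrimePower q → ∃[ t ] NonZero t × q ≡ suc (2 * t)
  oddPrimePower⇒odd (p , suc k , p-prime , p≢2 , _ , refl)
    with ¬2∣⇒odd (¬2∣^ (¬2∣odd-prime p-prime p≢2) (suc k))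
  ... | suc t , p^[1+k]≡q = suc t , _ , p^[1+k]≡q
  ... | zero  , p^[1+k]≡1 = contradiction (subst Prime (∣1⇒≡1 p∣1) p-prime) ¬prime[1]
    where
    p∣1 : p ∣ 1
    p∣1 = subst (p ∣_) p^[1+k]≡1 (subst (p ∣_) (*-comm (p ^ k) p) (n∣m*n (p ^ k)))

  n∣[n∸i]%n+i : ∀ n {i} .{{_ : NonZero n}} → i ≤ n → n ∣ (n ∸ i) % n + i
  n∣[n∸i]%n+i n {i} i≤n = m%n≡0⇒n∣m _ n (begin
    ((n ∸ i) % n + i) % n           ≡⟨ %-distribˡ-+ ((n ∸ i) % n) i n ⟩
    ((n ∸ i) % n % n + i % n) % n   ≡⟨ cong (λ a → (a + i % n) % n) (m%n%n≡m%n (n ∸ i) n) ⟩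
    ((n ∸ i) % n + i % n) % n       ≡⟨ %-distribˡ-+ (n ∸ i) i n ⟨
    ((n ∸ i) + i) % n               ≡⟨ cong (_% n) (m∸n+n≡m i≤n) ⟩
    n % n                           ≡⟨ n%n≡0 n ⟩
    0                               ∎)

  negMod<q²+1 : ∀ q i → negMod q i < q ^ 2 + 1
  negMod<q²+1 q i = subst (negMod q i <_) (+-comm 1 (q ^ 2)) (m%n<n (suc (q ^ 2) ∸ i) (suc (q ^ 2)))

  q²+1∣negMod+i : ∀ q {i} → i < q ^ 2 + 1 → q ^ 2 + 1 ∣ negMod q i + i
  q²+1∣negMod+i q {i} i<q²+1 = subst (_∣ negMod q i + i) (+-comm 1 (q ^ 2))
    (n∣[n∸i]%n+i (suc (q ^ 2)) (subst (i ≤_) (+-comm (q ^ 2) 1) (<⇒≤ i<q²+1)))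

  [Q+1]i+r≡[Q+1]m+iQ : ∀ Q r i m → r + i ≡ m * (Q + 1) → (Q + 1) * i + r ≡ (Q + 1) * m + i * Q
  [Q+1]i+r≡[Q+1]m+iQ Q r i m r+i≡m[Q+1] = begin
    (Q + 1) * i + r       ≡⟨ solve 3 (λ Q r i → (Q :+ con 1) :* i :+ r := (r :+ i) :+ i :* Q) refl Q r i ⟩
    (r + i) + i * Q       ≡⟨ cong (_+ i * Q) r+i≡m[Q+1] ⟩
    m * (Q + 1) + i * Q   ≡⟨ cong (_+ i * Q) (*-comm m (Q + 1)) ⟩
    (Q + 1) * m + i * Q   ∎

module OddExponents (t : ℕ) where
  open import Data.Nat
  open import Data.Nat.Properties using (*-suc; *-comm)
  open import Data.Nat.DivMod using (_/_; m*n/n≡m)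
  open import Data.Nat.Solver using (module +-*-Solver)
  open import Relation.Binary.PropositionalEquality
  open +-*-Solver using (solve; _:=_; _:+_; _:*_; _:^_; con; Polynomial)
  open ≡-Reasoning

  q : ℕ
  q = suc (2 * t)

  M : ℕ
  M = (q ^ 2 + 1) * (q + 1) * t

  private
    q̂ ĥ M̂ : Polynomial 1 → Polynomial 1
    q̂ t = con 1 :+ con 2 :* t
    ĥ t = con 2 :* t :* t :+ con 2 :* t :+ con 1
    M̂ t = (q̂ t :^ 2 :+ con 1) :* (q̂ t :+ con 1) :* t

  q⁴≡1+2M : q ^ 4 ≡ suc (M + M)
  q⁴≡1+2M = solve 1 (λ t → q̂ t :^ 4 := con 1 :+ (M̂ t :+ M̂ t)) refl t

  *q⁴≡+2M* : ∀ e → e * q ^ 4 ≡ e + (M + M) * e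
  *q⁴≡+2M* e = begin
    e * q ^ 4         ≡⟨ cong (e *_) q⁴≡1+2M ⟩
    e * suc (M + M)   ≡⟨ *-suc e (M + M) ⟩
    e + e * (M + M)   ≡⟨ cong (e +_) (*-comm e (M + M)) ⟩
    e + (M + M) * e   ∎

  [q+1][q²+1]q≡ : (q + 1) * (q ^ 2 + 1) * q ≡ (q + 1) * (q ^ 2 + 1) + (M + M) * 1
  [q+1][q²+1]q≡ = solve 1 (λ t →
      (q̂ t :+ con 1) :* (q̂ t :^ 2 :+ con 1) :* q̂ t
    := (q̂ t :+ con 1) :* (q̂ t :^ 2 :+ con 1) :+ (M̂ t :+ M̂ t) :* con 1) refl t

  halfMod≡ : halfMod q ≡ 2 * t * t + 2 * t + 1
  halfMod≡ = trans (cong (_/ 2) q²+1≡h*2) (m*n/n≡m (2 * t * t + 2 * t + 1) 2)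
    where
    q²+1≡h*2 : q ^ 2 + 1 ≡ (2 * t * t + 2 * t + 1) * 2
    q²+1≡h*2 = solve 1 (λ t → q̂ t :^ 2 :+ con 1 := ĥ t :* con 2) refl t

  [q+1]hq≡[q+1]h+M : (q + 1) * halfMod q * q ≡ (q + 1) * halfMod q + M
  [q+1]hq≡[q+1]h+M rewrite halfMod≡ =
    solve 1 (λ t → (q̂ t :+ con 1) :* ĥ t :* q̂ t := (q̂ t :+ con 1) :* ĥ t :+ M̂ t) refl t

module RingProperties {c ℓ : Level} (R : CommutativeRing c ℓ) where
  open CommutativeRing R
  open import Algebra.Properties.CommutativeSemiring.Exp commutativeSemiring
  open import Algebra.Properties.Ring ring using (-1*x≈-x; -‿involutive; -‿distribˡ-*; -‿distribʳ-*; +-inverseʳ-unique)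
  open import Relation.Binary.Reasoning.Setoid setoid

  1#^≈1# : ∀ k → 1# ^ k ≈ 1#
  1#^≈1# zero    = refl
  1#^≈1# (suc k) = trans (*-identityˡ (1# ^ k)) (1#^≈1# k)

  -1#^odd≈-1# : ∀ t → (- 1#) ^ suc (2 ℕ.* t) ≈ - 1#
  -1#^odd≈-1# t = begin
    - 1# * (- 1#) ^ (2 ℕ.* t)   ≈⟨ *-congˡ (^-assocʳ (- 1#) 2 t) ⟨
    - 1# * ((- 1#) ^ 2) ^ t     ≈⟨ *-congˡ (^-congˡ t [-1]²≈1) ⟩
    - 1# * 1# ^ t               ≈⟨ *-congˡ (1#^≈1# t) ⟩
    - 1# * 1#                   ≈⟨ *-identityʳ (- 1#) ⟩
    - 1#                        ∎
    where
    [-1]²≈1 : (- 1#) ^ 2 ≈ 1#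
    [-1]²≈1 = begin
      - 1# * (- 1# * 1#)   ≈⟨ *-congˡ (*-identityʳ (- 1#)) ⟩
      - 1# * - 1#          ≈⟨ -1*x≈-x (- 1#) ⟩
      - - 1#               ≈⟨ -‿involutive 1# ⟩
      1#                   ∎

  -x*-y≈x*y : ∀ x y → - x * - y ≈ x * y
  -x*-y≈x*y x y = begin
    - x * - y     ≈⟨ -‿distribˡ-* x (- y) ⟨
    - (x * - y)   ≈⟨ -‿cong (-‿distribʳ-* x y) ⟨
    - - (x * y)   ≈⟨ -‿involutive (x * y) ⟩
    x * y         ∎

  -1≉1⇒1+1≉0 : ¬ - 1# ≈ 1# → ¬ 1# + 1# ≈ 0#
  -1≉1⇒1+1≉0 -1≉1 1+1≈0 = -1≉1 (sym (+-inverseʳ-unique 1# 1# 1+1≈0))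

module FieldProperties {c ℓ : Level} (F : CommutativeRing c ℓ) (isField : IsField F) where
  open CommutativeRing F
  open import Algebra.Properties.CommutativeSemiring.Exp commutativeSemiring
  open import Algebra.Properties.Ring ring using ([y-z]x≈yx-zx; +-inverseˡ-unique; x∙y⁻¹≈ε⇒x≈y)
  open import Relation.Binary.Reasoning.Setoid setoid

  1#≉0# : ¬ 1# ≈ 0#
  1#≉0# = proj₁ isField

  x≉0∧x*y≈0⇒y≈0 : ∀ {x y} → ¬ x ≈ 0# → x * y ≈ 0# → y ≈ 0#
  x≉0∧x*y≈0⇒y≈0 {x} {y} x≉0 x*y≈0 with proj₂ isField x x≉0
  ... | x⁻¹ , x*x⁻¹≈1 = begin
    y               ≈⟨ *-identityˡ y ⟨
    1# * y          ≈⟨ *-congʳ x*x⁻¹≈1 ⟨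
    x * x⁻¹ * y     ≈⟨ *-congʳ (*-comm x x⁻¹) ⟩
    x⁻¹ * x * y     ≈⟨ *-assoc x⁻¹ x y ⟩
    x⁻¹ * (x * y)   ≈⟨ *-congˡ x*y≈0 ⟩
    x⁻¹ * 0#        ≈⟨ zeroʳ x⁻¹ ⟩
    0#              ∎

  *-≉0 : ∀ {x y} → ¬ x ≈ 0# → ¬ y ≈ 0# → ¬ x * y ≈ 0#
  *-≉0 x≉0 y≉0 x*y≈0 = y≉0 (x≉0∧x*y≈0⇒y≈0 x≉0 x*y≈0)

  ^-≉0 : ∀ {x} → ¬ x ≈ 0# → ∀ k → ¬ x ^ k ≈ 0#
  ^-≉0 x≉0 zero    = 1#≉0#
  ^-≉0 x≉0 (suc k) = *-≉0 x≉0 (^-≉0 x≉0 k)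

  x^k≈1⇒x≉0 : ∀ {x k} → 0 ℕ.< k → x ^ k ≈ 1# → ¬ x ≈ 0#
  x^k≈1⇒x≉0 {x} {suc k} _ x*x^k≈1 x≈0 = 1#≉0# (begin
    1#           ≈⟨ x*x^k≈1 ⟨
    x * x ^ k    ≈⟨ *-congʳ x≈0 ⟩
    0# * x ^ k   ≈⟨ zeroˡ (x ^ k) ⟩
    0#           ∎)

  x*x≈1∧x≉1⇒x≈-1 : ∀ {x} → x * x ≈ 1# → ¬ x ≈ 1# → x ≈ - 1#
  x*x≈1∧x≉1⇒x≈-1 {x} x*x≈1 x≉1 = +-inverseˡ-unique x 1# (x≉0∧x*y≈0⇒y≈0 x-1≉0 [x-1][x+1]≈0)
    where
    x-1≉0 : ¬ x - 1# ≈ 0#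
    x-1≉0 x-1≈0 = x≉1 (x∙y⁻¹≈ε⇒x≈y x 1# x-1≈0)

    x[x+1]≈x+1 : x * (x + 1#) ≈ x + 1#
    x[x+1]≈x+1 = begin
      x * (x + 1#)     ≈⟨ distribˡ x x 1# ⟩
      x * x + x * 1#   ≈⟨ +-cong x*x≈1 (*-identityʳ x) ⟩
      1# + x           ≈⟨ +-comm 1# x ⟩
      x + 1#           ∎

    [x-1][x+1]≈0 : (x - 1#) * (x + 1#) ≈ 0#
    [x-1][x+1]≈0 = begin
      (x - 1#) * (x + 1#)            ≈⟨ [y-z]x≈yx-zx (x + 1#) x 1# ⟩
      x * (x + 1#) - 1# * (x + 1#)   ≈⟨ +-cong x[x+1]≈x+1 (-‿cong (*-identityˡ (x + 1#))) ⟩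
      (x + 1#) - (x + 1#)            ≈⟨ -‿inverseʳ (x + 1#) ⟩
      0#                             ∎

  x+x≈0⇒x≈0 : ∀ {x} → ¬ 1# + 1# ≈ 0# → x + x ≈ 0# → x ≈ 0#
  x+x≈0⇒x≈0 {x} 1+1≉0 x+x≈0 = x≉0∧x*y≈0⇒y≈0 1+1≉0 (begin
    (1# + 1#) * x     ≈⟨ distribʳ x 1# 1# ⟩
    1# * x + 1# * x   ≈⟨ +-cong (*-identityˡ x) (*-identityˡ x) ⟩
    x + x             ≈⟨ x+x≈0 ⟩
    0#                ∎)

module Conjugates {c ℓ : Level} (R : CommutativeRing c ℓ) (q : ℕ) where
  open CommutativeRing R
  open import Algebra.Properties.CommutativeSemiring.Exp commutativeSemiring
  open import Algebra.Solver.Ring.NaturalCoefficients.Default commutativeSemiring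
  open import Relation.Binary.Reasoning.Setoid setoid

  conj : ℕ → Carrier → Carrier
  conj k a = a ^ (q ℕ.^ k)

  conj-cong : ∀ k {a b} → a ≈ b → conj k a ≈ conj k b
  conj-cong k = ^-congˡ (q ℕ.^ k)

  conj-zero : ∀ a → conj 0 a ≈ a
  conj-zero = *-identityʳ

  conj-suc : ∀ k a → conj (suc k) a ≈ conj k a ^ q
  conj-suc k a = begin
    a ^ (q ℕ.* q ℕ.^ k)   ≈⟨ ^-congʳ a (ℕₚ.*-comm q (q ℕ.^ k)) ⟩
    a ^ (q ℕ.^ k ℕ.* q)   ≈⟨ ^-assocʳ a (q ℕ.^ k) q ⟨
    conj k a ^ q          ∎

  conj-one : ∀ a → conj 1 a ≈ a ^ q
  conj-one a = trans (conj-suc 0 a) (^-congˡ q (conj-zero a))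

  conj-conj : ∀ j k a → conj j (conj k a) ≈ conj (j ℕ.+ k) a
  conj-conj zero    k a = conj-zero (conj k a)
  conj-conj (suc j) k a = begin
    conj (suc j) (conj k a)   ≈⟨ conj-suc j (conj k a) ⟩
    conj j (conj k a) ^ q     ≈⟨ ^-congˡ q (conj-conj j k a) ⟩
    conj (j ℕ.+ k) a ^ q      ≈⟨ conj-suc (j ℕ.+ k) a ⟨
    conj (suc j ℕ.+ k) a      ∎

  Tr-cong : ∀ {a b} → a ≈ b → Tr R q a ≈ Tr R q b
  Tr-cong a≈b = +-cong (+-cong (+-cong a≈b (^-congˡ q a≈b)) (conj-cong 2 a≈b)) (conj-cong 3 a≈b)

  Tr-* : ∀ a b → Tr R q (a * b) ≈ a * b + a ^ q * b ^ q + conj 2 a * conj 2 b + conj 3 a * conj 3 b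
  Tr-* a b = +-cong (+-cong (+-congˡ (^-distrib-* a b q)) (^-distrib-* a b (q ℕ.^ 2))) (^-distrib-* a b (q ℕ.^ 3))

  Tr-conj² : ∀ {a} → conj 4 a ≈ a → Tr R q (conj 2 a) ≈ Tr R q a
  Tr-conj² {a} conj⁴a≈a = begin
    conj 2 a + conj 2 a ^ q + conj 2 (conj 2 a) + conj 3 (conj 2 a)
      ≈⟨ +-cong (+-cong (+-congˡ (sym (conj-suc 2 a))) (trans (conj-conj 2 2 a) conj⁴a≈a)) conj³[conj²a]≈a^q ⟩
    conj 2 a + conj 3 a + a + a ^ q
      ≈⟨ solve 4 (λ a₀ a₁ a₂ a₃ → a₂ :+ a₃ :+ a₀ :+ a₁ := a₀ :+ a₁ :+ a₂ :+ a₃) refl a (a ^ q) (conj 2 a) (conj 3 a) ⟩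
    a + a ^ q + conj 2 a + conj 3 a
      ∎
    where
    conj³[conj²a]≈a^q : conj 3 (conj 2 a) ≈ a ^ q
    conj³[conj²a]≈a^q = begin
      conj 3 (conj 2 a)   ≈⟨ conj-conj 3 2 a ⟩
      conj 5 a            ≈⟨ conj-conj 1 4 a ⟨
      conj 1 (conj 4 a)   ≈⟨ conj-cong 1 conj⁴a≈a ⟩
      conj 1 a            ≈⟨ conj-one a ⟩
      a ^ q               ∎

  Fixed : Carrier → Set ℓ
  Fixed a = a ^ q ≈ a

  Fixed-resp-≈ : ∀ {a b} → a ≈ b → Fixed a → Fixed b
  Fixed-resp-≈ a≈b a^q≈a = trans (^-congˡ q (sym a≈b)) (trans a^q≈a a≈b)

  Fixed-^ : ∀ {a} → Fixed a → ∀ k → Fixed (a ^ k)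
  Fixed-^ {a} a^q≈a k = begin
    (a ^ k) ^ q     ≈⟨ ^-assocʳ a k q ⟩
    a ^ (k ℕ.* q)   ≈⟨ ^-congʳ a (ℕₚ.*-comm k q) ⟩
    a ^ (q ℕ.* k)   ≈⟨ ^-assocʳ a q k ⟨
    (a ^ q) ^ k     ≈⟨ ^-congˡ k a^q≈a ⟩
    a ^ k           ∎

  conj-Fixed : ∀ {a} → Fixed a → ∀ k → conj k a ≈ a
  conj-Fixed {a} _     zero    = conj-zero a
  conj-Fixed {a} a^q≈a (suc k) = begin
    conj (suc k) a   ≈⟨ conj-suc k a ⟩
    conj k a ^ q     ≈⟨ ^-congˡ q (conj-Fixed a^q≈a k) ⟩
    a ^ q            ≈⟨ a^q≈a ⟩
    a                ∎

  Tr-*-Fixed : ∀ {a} → Fixed a → ∀ b → Tr R q (a * b) ≈ a * Tr R q b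
  Tr-*-Fixed {a} a^q≈a b = begin
    Tr R q (a * b)
      ≈⟨ Tr-* a b ⟩
    a * b + a ^ q * b ^ q + conj 2 a * conj 2 b + conj 3 a * conj 3 b
      ≈⟨ +-cong (+-cong (+-congˡ (*-congʳ a^q≈a)) (*-congʳ (conj-Fixed a^q≈a 2))) (*-congʳ (conj-Fixed a^q≈a 3)) ⟩
    a * b + a * b ^ q + a * conj 2 b + a * conj 3 b
      ≈⟨ solve 5 (λ a b₀ b₁ b₂ b₃ → a :* b₀ :+ a :* b₁ :+ a :* b₂ :+ a :* b₃ := a :* (b₀ :+ b₁ :+ b₂ :+ b₃))
           refl a b (b ^ q) (conj 2 b) (conj 3 b) ⟩
    a * Tr R q b
      ∎

  η^i*γ^r≈η^m*conj²γ^i : ∀ γ i r m → r ℕ.+ i ≡ m ℕ.* (q ℕ.^ 2 ℕ.+ 1) →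
                         (γ ^ (q ℕ.^ 2 ℕ.+ 1)) ^ i * γ ^ r ≈ (γ ^ (q ℕ.^ 2 ℕ.+ 1)) ^ m * conj 2 (γ ^ i)
  η^i*γ^r≈η^m*conj²γ^i γ i r m r+i≡m[Q+1] = begin
    (γ ^ (Q ℕ.+ 1)) ^ i * γ ^ r             ≈⟨ *-congʳ (^-assocʳ γ (Q ℕ.+ 1) i) ⟩
    γ ^ ((Q ℕ.+ 1) ℕ.* i) * γ ^ r           ≈⟨ ^-homo-* γ ((Q ℕ.+ 1) ℕ.* i) r ⟨
    γ ^ ((Q ℕ.+ 1) ℕ.* i ℕ.+ r)             ≈⟨ ^-congʳ γ (Arithmetic.[Q+1]i+r≡[Q+1]m+iQ Q r i m r+i≡m[Q+1]) ⟩
    γ ^ ((Q ℕ.+ 1) ℕ.* m ℕ.+ i ℕ.* Q)       ≈⟨ ^-homo-* γ ((Q ℕ.+ 1) ℕ.* m) (i ℕ.* Q) ⟩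
    γ ^ ((Q ℕ.+ 1) ℕ.* m) * γ ^ (i ℕ.* Q)   ≈⟨ *-cong (^-assocʳ γ (Q ℕ.+ 1) m) (^-assocʳ γ i Q) ⟨
    (γ ^ (Q ℕ.+ 1)) ^ m * conj 2 (γ ^ i)    ∎
    where
    Q : ℕ
    Q = q ℕ.^ 2

module OddTrace {c ℓ : Level} (F : CommutativeRing c ℓ) (isField : IsField F) (t : ℕ) where
  open CommutativeRing F
  open import Algebra.Properties.CommutativeSemiring.Exp commutativeSemiring
  open import Algebra.Properties.Ring ring using (-1*x≈-x; -‿distribˡ-*; -‿involutive; -0#≈0#; +-inverseʳ-unique)
  open import Algebra.Properties.CommutativeSemigroup *-commutativeSemigroup using (x∙yz≈y∙xz)
  open import Algebra.Solver.Ring.NaturalCoefficients.Default commutativeSemiring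
  open import Relation.Binary.Reasoning.Setoid setoid
  open RingProperties F using (-1#^odd≈-1#; -x*-y≈x*y)
  open FieldProperties F isField

  q : ℕ
  q = suc (2 ℕ.* t)

  open Conjugates F q public

  ^q-neg : ∀ a → (- a) ^ q ≈ - (a ^ q)
  ^q-neg a = begin
    (- a) ^ q            ≈⟨ ^-congˡ q (-1*x≈-x a) ⟨
    (- 1# * a) ^ q       ≈⟨ ^-distrib-* (- 1#) a q ⟩
    (- 1#) ^ q * a ^ q   ≈⟨ *-congʳ (-1#^odd≈-1# t) ⟩
    - 1# * a ^ q         ≈⟨ -1*x≈-x (a ^ q) ⟩
    - (a ^ q)            ∎

  Tr-neg : ∀ a → Tr F q (- a) ≈ - Tr F q a
  Tr-neg a = begin
    Tr F q (- a)        ≈⟨ Tr-cong (-1*x≈-x a) ⟨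
    Tr F q (- 1# * a)   ≈⟨ Tr-*-Fixed (-1#^odd≈-1# t) a ⟩
    - 1# * Tr F q a     ≈⟨ -1*x≈-x (Tr F q a) ⟩
    - Tr F q a          ∎

  Tr-*-antiFixed : ∀ β {g} → g ^ q ≈ - g → Tr F q (β * g) ≈ g * (β + conj 2 β) + - g * (β ^ q + conj 3 β)
  Tr-*-antiFixed β {g} g^q≈-g = begin
    Tr F q (β * g)
      ≈⟨ Tr-* β g ⟩
    β * g + β ^ q * g ^ q + conj 2 β * conj 2 g + conj 3 β * conj 3 g
      ≈⟨ +-cong (+-cong (+-congˡ (*-congˡ g^q≈-g)) (*-congˡ conj²g≈g)) (*-congˡ conj³g≈-g) ⟩
    β * g + β ^ q * - g + conj 2 β * g + conj 3 β * - g
      ≈⟨ solve 6 (λ b₀ b₁ b₂ b₃ g h → b₀ :* g :+ b₁ :* h :+ b₂ :* g :+ b₃ :* h := g :* (b₀ :+ b₂) :+ h :* (b₁ :+ b₃))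
           refl β (β ^ q) (conj 2 β) (conj 3 β) g (- g) ⟩
    g * (β + conj 2 β) + - g * (β ^ q + conj 3 β)
      ∎
    where
    conj²g≈g : conj 2 g ≈ g
    conj²g≈g = begin
      conj 2 g       ≈⟨ conj-suc 1 g ⟩
      conj 1 g ^ q   ≈⟨ ^-congˡ q (trans (conj-one g) g^q≈-g) ⟩
      (- g) ^ q      ≈⟨ ^q-neg g ⟩
      - (g ^ q)      ≈⟨ -‿cong g^q≈-g ⟩
      - - g          ≈⟨ -‿involutive g ⟩
      g              ∎

    conj³g≈-g : conj 3 g ≈ - g
    conj³g≈-g = trans (conj-suc 2 g) (trans (^-congˡ q conj²g≈g) g^q≈-g)

  Tr≈0⇒conj²≈- : ∀ {β g} → ¬ 1# + 1# ≈ 0# → ¬ g ≈ 0# → g ^ q ≈ - g →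
                 Tr F q β ≈ 0# → Tr F q (β * g) ≈ 0# → conj 2 β ≈ - β
  Tr≈0⇒conj²≈- {β} {g} 1+1≉0 g≉0 g^q≈-g Trβ≈0 Tr[βg]≈0 =
    +-inverseʳ-unique β (conj 2 β) (x≉0∧x*y≈0⇒y≈0 g≉0 (x+x≈0⇒x≈0 1+1≉0 gu+gu≈0))
    where
    u v : Carrier
    u = β + conj 2 β
    v = β ^ q + conj 3 β

    v≈-u : v ≈ - u
    v≈-u = +-inverseʳ-unique u v (begin
      u + v      ≈⟨ solve 4 (λ b₀ b₁ b₂ b₃ → (b₀ :+ b₂) :+ (b₁ :+ b₃) := b₀ :+ b₁ :+ b₂ :+ b₃)
                      refl β (β ^ q) (conj 2 β) (conj 3 β) ⟩
      Tr F q β   ≈⟨ Trβ≈0 ⟩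
      0#         ∎)

    gu+gu≈0 : g * u + g * u ≈ 0#
    gu+gu≈0 = begin
      g * u + g * u     ≈⟨ +-congˡ (trans (*-congˡ v≈-u) (-x*-y≈x*y g u)) ⟨
      g * u + - g * v   ≈⟨ Tr-*-antiFixed β g^q≈-g ⟨
      Tr F q (β * g)    ≈⟨ Tr[βg]≈0 ⟩
      0#                ∎

  Tr[βγ^i]≈0⇒Tr[βγ^r]≈0 : ∀ {β γ} → ¬ γ ≈ 0# → Fixed (γ ^ (q ℕ.^ 2 ℕ.+ 1)) → conj 2 β ≈ - β →
                          ∀ i r → conj 4 (β * γ ^ i) ≈ β * γ ^ i → q ℕ.^ 2 ℕ.+ 1 ∣ r ℕ.+ i →
                          Tr F q (β * γ ^ i) ≈ 0# → Tr F q (β * γ ^ r) ≈ 0#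
  Tr[βγ^i]≈0⇒Tr[βγ^r]≈0 {β} {γ} γ≉0 η-fixed conj²β≈-β i r conj⁴y≈y (divides m r+i≡m[q²+1]) Tr-y≈0 =
    x≉0∧x*y≈0⇒y≈0 (^-≉0 (^-≉0 γ≉0 (q ℕ.^ 2 ℕ.+ 1)) i) (begin
      η ^ i * Tr F q (β * γ ^ r)     ≈⟨ Tr-*-Fixed (Fixed-^ η-fixed i) (β * γ ^ r) ⟨
      Tr F q (η ^ i * (β * γ ^ r))   ≈⟨ Tr-cong shift ⟩
      Tr F q (η ^ m * (β * X))       ≈⟨ Tr-*-Fixed (Fixed-^ η-fixed m) (β * X) ⟩
      η ^ m * Tr F q (β * X)         ≈⟨ *-congˡ Tr[βX]≈0 ⟩
      η ^ m * 0#                     ≈⟨ zeroʳ (η ^ m) ⟩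
      0#                             ∎)
    where
    η y X : Carrier
    η = γ ^ (q ℕ.^ 2 ℕ.+ 1)
    y = β * γ ^ i
    X = conj 2 (γ ^ i)

    shift : η ^ i * (β * γ ^ r) ≈ η ^ m * (β * X)
    shift = begin
      η ^ i * (β * γ ^ r)   ≈⟨ x∙yz≈y∙xz (η ^ i) β (γ ^ r) ⟩
      β * (η ^ i * γ ^ r)   ≈⟨ *-congˡ (η^i*γ^r≈η^m*conj²γ^i γ i r m r+i≡m[q²+1]) ⟩
      β * (η ^ m * X)       ≈⟨ x∙yz≈y∙xz β (η ^ m) X ⟩
      η ^ m * (β * X)       ∎

    conj²y≈-βX : conj 2 y ≈ - (β * X)
    conj²y≈-βX = begin
      conj 2 y       ≈⟨ ^-distrib-* β (γ ^ i) (q ℕ.^ 2) ⟩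
      conj 2 β * X   ≈⟨ *-congʳ conj²β≈-β ⟩
      - β * X        ≈⟨ -‿distribˡ-* β X ⟨
      - (β * X)      ∎

    Tr[βX]≈0 : Tr F q (β * X) ≈ 0#
    Tr[βX]≈0 = begin
      Tr F q (β * X)         ≈⟨ -‿involutive (Tr F q (β * X)) ⟨
      - - Tr F q (β * X)     ≈⟨ -‿cong (Tr-neg (β * X)) ⟨
      - Tr F q (- (β * X))   ≈⟨ -‿cong (Tr-cong conj²y≈-βX) ⟨
      - Tr F q (conj 2 y)    ≈⟨ -‿cong (Tr-conj² conj⁴y≈y) ⟩
      - Tr F q y             ≈⟨ -‿cong Tr-y≈0 ⟩
      - 0#                   ≈⟨ -0#≈0# ⟩
      0#                     ∎

module PrimitiveElement {c ℓ : Level} (F : CommutativeRing c ℓ) (isField : IsField F)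
                        (t : ℕ) .{{_ : NonZero t}} (α : CommutativeRing.Carrier F)
                        (prim : IsPrimitive F (suc (2 ℕ.* t) ℕ.^ 4 ∸ 1) α) where
  open CommutativeRing F
  open import Algebra.Properties.CommutativeSemiring.Exp commutativeSemiring
  open import Algebra.Properties.Ring ring using (-‿distribʳ-*)
  open import Relation.Binary.Reasoning.Setoid setoid
  open RingProperties F using (1#^≈1#; -1≉1⇒1+1≉0)
  open FieldProperties F isField
  open OddTrace F isField t
  open OddExponents t using (M; q⁴≡1+2M; *q⁴≡+2M*; [q+1][q²+1]q≡; [q+1]hq≡[q+1]h+M)

  N≡M+M : q ℕ.^ 4 ∸ 1 ≡ M ℕ.+ M
  N≡M+M = ≡.cong (_∸ 1) q⁴≡1+2M

  α^[M+M]≈1 : α ^ (M ℕ.+ M) ≈ 1#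
  α^[M+M]≈1 = trans (^-congʳ α (≡.sym N≡M+M)) (proj₁ prim)

  α^-periodic : ∀ e k → α ^ (e ℕ.+ (M ℕ.+ M) ℕ.* k) ≈ α ^ e
  α^-periodic e k = begin
    α ^ (e ℕ.+ (M ℕ.+ M) ℕ.* k)     ≈⟨ ^-homo-* α e ((M ℕ.+ M) ℕ.* k) ⟩
    α ^ e * α ^ ((M ℕ.+ M) ℕ.* k)   ≈⟨ *-congˡ (^-assocʳ α (M ℕ.+ M) k) ⟨
    α ^ e * (α ^ (M ℕ.+ M)) ^ k     ≈⟨ *-congˡ (^-congˡ k α^[M+M]≈1) ⟩
    α ^ e * 1# ^ k                  ≈⟨ *-congˡ (1#^≈1# k) ⟩
    α ^ e * 1#                      ≈⟨ *-identityʳ (α ^ e) ⟩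
    α ^ e                           ∎

  α^-cong-mod : ∀ {e e′} k → e ≡ e′ ℕ.+ (M ℕ.+ M) ℕ.* k → α ^ e ≈ α ^ e′
  α^-cong-mod {e′ = e′} k e≡e′+[M+M]k = trans (^-congʳ α e≡e′+[M+M]k) (α^-periodic e′ k)

  0<M : 0 ℕ.< M
  0<M = ℕ.>-nonZero⁻¹ M {{ℕₚ.m*n≢0 ((q ℕ.^ 2 ℕ.+ 1) ℕ.* (q ℕ.+ 1)) t {{ℕₚ.m*n≢0 (q ℕ.^ 2 ℕ.+ 1) (q ℕ.+ 1)}}}}

  α^M≉1 : ¬ α ^ M ≈ 1#
  α^M≉1 = proj₁ (proj₂ prim) M 0<M (≡.subst (M ℕ.<_) (≡.sym N≡M+M) (ℕₚ.m<m+n M 0<M))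

  α^M≈-1 : α ^ M ≈ - 1#
  α^M≈-1 = x*x≈1∧x≉1⇒x≈-1 (trans (sym (^-homo-* α M M)) α^[M+M]≈1) α^M≉1

  1+1≉0 : ¬ 1# + 1# ≈ 0#
  1+1≉0 = -1≉1⇒1+1≉0 (λ -1≈1 → α^M≉1 (trans α^M≈-1 -1≈1))

  α≉0 : ¬ α ≈ 0#
  α≉0 = x^k≈1⇒x≉0 (ℕₚ.<-≤-trans 0<M (ℕₚ.m≤m+n M M)) α^[M+M]≈1

  conj⁴-α^ : ∀ e → conj 4 (α ^ e) ≈ α ^ e
  conj⁴-α^ e = trans (^-assocʳ α e (q ℕ.^ 4)) (α^-cong-mod e (*q⁴≡+2M* e))

  γ : Carrier
  γ = α ^ (q ℕ.+ 1)

  γ≉0 : ¬ γ ≈ 0#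
  γ≉0 = ^-≉0 α≉0 (q ℕ.+ 1)

  α^[x+[q+1]i]≈α^x*γ^i : ∀ x i → α ^ (x ℕ.+ (q ℕ.+ 1) ℕ.* i) ≈ α ^ x * γ ^ i
  α^[x+[q+1]i]≈α^x*γ^i x i = trans (^-homo-* α x ((q ℕ.+ 1) ℕ.* i)) (*-congˡ (sym (^-assocʳ α (q ℕ.+ 1) i)))

  γ^[q²+1]-Fixed : Fixed (γ ^ (q ℕ.^ 2 ℕ.+ 1))
  γ^[q²+1]-Fixed = Fixed-resp-≈ (sym (^-assocʳ α (q ℕ.+ 1) (q ℕ.^ 2 ℕ.+ 1)))
    (trans (^-assocʳ α ((q ℕ.+ 1) ℕ.* (q ℕ.^ 2 ℕ.+ 1)) q) (α^-cong-mod 1 [q+1][q²+1]q≡))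

  γ^h^q≈-γ^h : (γ ^ halfMod q) ^ q ≈ - (γ ^ halfMod q)
  γ^h^q≈-γ^h = begin
    (γ ^ h) ^ q                     ≈⟨ ^-congˡ q (^-assocʳ α (q ℕ.+ 1) h) ⟩
    (α ^ ((q ℕ.+ 1) ℕ.* h)) ^ q     ≈⟨ ^-assocʳ α ((q ℕ.+ 1) ℕ.* h) q ⟩
    α ^ ((q ℕ.+ 1) ℕ.* h ℕ.* q)     ≈⟨ ^-congʳ α [q+1]hq≡[q+1]h+M ⟩
    α ^ ((q ℕ.+ 1) ℕ.* h ℕ.+ M)     ≈⟨ ^-homo-* α ((q ℕ.+ 1) ℕ.* h) M ⟩
    α ^ ((q ℕ.+ 1) ℕ.* h) * α ^ M   ≈⟨ *-cong (^-assocʳ α (q ℕ.+ 1) h) (sym α^M≈-1) ⟨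
    γ ^ h * - 1#                    ≈⟨ -‿distribʳ-* (γ ^ h) 1# ⟨
    - (γ ^ h * 1#)                  ≈⟨ -‿cong (*-identityʳ (γ ^ h)) ⟩
    - (γ ^ h)                       ∎
    where
    h : ℕ
    h = halfMod q

  module _ (x : ℕ) where
    β : Carrier
    β = α ^ x

    Tr[α^[x+[q+1]i]]≈Tr[βγ^i] : ∀ i → Tr F q (α ^ (x ℕ.+ (q ℕ.+ 1) ℕ.* i)) ≈ Tr F q (β * γ ^ i)
    Tr[α^[x+[q+1]i]]≈Tr[βγ^i] i = Tr-cong (α^[x+[q+1]i]≈α^x*γ^i x i)

    InC⇒Tr[βγ^i]≈0 : ∀ {i} → InC F q α x i → Tr F q (β * γ ^ i) ≈ 0#
    InC⇒Tr[βγ^i]≈0 {i} (_ , Tr≈0) = trans (sym (Tr[α^[x+[q+1]i]]≈Tr[βγ^i] i)) Tr≈0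

    conj⁴[βγ^i]≈βγ^i : ∀ i → conj 4 (β * γ ^ i) ≈ β * γ ^ i
    conj⁴[βγ^i]≈βγ^i i = begin
      conj 4 (β * γ ^ i)                     ≈⟨ conj-cong 4 (α^[x+[q+1]i]≈α^x*γ^i x i) ⟨
      conj 4 (α ^ (x ℕ.+ (q ℕ.+ 1) ℕ.* i))   ≈⟨ conj⁴-α^ (x ℕ.+ (q ℕ.+ 1) ℕ.* i) ⟩
      α ^ (x ℕ.+ (q ℕ.+ 1) ℕ.* i)            ≈⟨ α^[x+[q+1]i]≈α^x*γ^i x i ⟩
      β * γ ^ i                              ∎

    conj²β≈-β : InC F q α x 0 → InC F q α x (halfMod q) → conj 2 β ≈ - β
    conj²β≈-β 0∈Cₓ h∈Cₓ = Tr≈0⇒conj²≈- 1+1≉0 (^-≉0 γ≉0 (halfMod q)) γ^h^q≈-γ^h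
      (trans (Tr-cong (sym (*-identityʳ β))) (InC⇒Tr[βγ^i]≈0 0∈Cₓ)) (InC⇒Tr[βγ^i]≈0 h∈Cₓ)

    negMod-closed : InC F q α x 0 → InC F q α x (halfMod q) →
                    ∀ i → InC F q α x i → InC F q α x (negMod q i)
    negMod-closed 0∈Cₓ h∈Cₓ i i∈Cₓ@(i<q²+1 , _) =
      Arithmetic.negMod<q²+1 q i ,
      trans (Tr[α^[x+[q+1]i]]≈Tr[βγ^i] (negMod q i))
        (Tr[βγ^i]≈0⇒Tr[βγ^r]≈0 γ≉0 γ^[q²+1]-Fixed (conj²β≈-β 0∈Cₓ h∈Cₓ) i (negMod q i)
          (conj⁴[βγ^i]≈βγ^i i) (Arithmetic.q²+1∣negMod+i q i<q²+1) (InC⇒Tr[βγ^i]≈0 i∈Cₓ))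

open import Data.Nat using (_^_)

mainTheorem14 : {c ℓ : Level} (F : CommutativeRing c ℓ) (q : ℕ) (α : CommutativeRing.Carrier F) →
    OddPrimePower q → IsField F → IsPrimitive F (q ^ 4 ∸ 1) α →
    (x : ℕ) → InD F q α x →
    InC F q α x 0 → InC F q α x (halfMod q) →
    ∀ i → InC F q α x i → InC F q α x (negMod q i)
mainTheorem14 F q α q-oddPrimePower isField prim x _ 0∈Cₓ h∈Cₓ i i∈Cₓ
  with Arithmetic.oddPrimePower⇒odd q-oddPrimePower
... | t , t≢0 , ≡.refl = PrimitiveElement.negMod-closed F isField t {{t≢0}} α prim x 0∈Cₓ h∈Cₓ i i∈Cₓ
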